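{- Let $a\in\mathbb{N}$ with $a\geq 3$, and let $S(a)$ be the submonoid of $(\mathbb{N},+)$ generated by $\{f_a+f_n\mid n\in\mathbb{N}\}$. Then $\{f_n\mid n\geq a\}\subseteq S(a)$.
   Context: $\{f_n\}$ is the Fibonacci sequence ($f_0=0$, $f_1=1$, $f_{n+2}=f_{n+1}+f_n$). -}

module Defs where

open import Data.Nat using (ℕ; zero; suc; _+_)
open import Data.Product using (∃)
open import Relation.Binary.PropositionalEquality using (_≡_)

fib : ℕ → ℕ
fib zero = 0
fib (suc zero) = 1
fib (suc (suc n)) = fib (suc n) + fib n

data Submonoid (G : ℕ → Set) : ℕ → Set where
  zero∈ : Submonoid G 0
  gen∈  : ∀ {x} → G x → Submonoid G x
  add∈  : ∀ {x y} → Submonoid G x → Submonoid G y → Submonoid G (x + y)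

Gen : ℕ → ℕ → Set
Gen a x = ∃ λ n → x ≡ fib a + fib n

S : ℕ → ℕ → Set
S a = Submonoid (Gen a)

{-# OPTIONS --safe #-}
module Submission where

open import Defs
open import Data.Nat using (ℕ; zero; suc; _≤_; _≤′_; ≤′-reflexive; ≤′-step)
open import Data.Nat.Properties using (+-identityʳ; ≤⇒≤′)
open import Data.Product using (_×_; _,_; proj₁)
open import Relation.Binary.PropositionalEquality using (refl; sym)

-- Both f_a = f_a + f_0 and f_(a+1) = f_a + f_(a-1) are generators of S(a), and a
-- submonoid containing two consecutive Fibonacci numbers contains all later ones.
-- This works for every a.

fib-consecutive∈ : ∀ {G m n} → Submonoid G (fib m) → Submonoid G (fib (suc m)) →
                   m ≤′ n → Submonoid G (fib n) × Submonoid G (fib (suc n))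
fib-consecutive∈ fm∈ fsm∈ (≤′-reflexive refl) = fm∈ , fsm∈
fib-consecutive∈ fm∈ fsm∈ (≤′-step m≤′n) with fib-consecutive∈ fm∈ fsm∈ m≤′n
... | fn∈ , fsn∈ = fsn∈ , add∈ fsn∈ fn∈

fib∈S : ∀ a → S a (fib a)
fib∈S a = gen∈ (0 , sym (+-identityʳ (fib a)))

fib-suc∈S : ∀ a → S a (fib (suc a))
fib-suc∈S zero    = gen∈ (1 , refl)
fib-suc∈S (suc b) = gen∈ (b , refl)

fib-≥∈S : ∀ {a n} → a ≤ n → S a (fib n)
fib-≥∈S {a} a≤n = proj₁ (fib-consecutive∈ (fib∈S a) (fib-suc∈S a) (≤⇒≤′ a≤n))

proposition10 : ∀ (a : ℕ) → 3 ≤ a → ∀ (n : ℕ) → a ≤ n → S a (fib n)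
proposition10 _ _ _ = fib-≥∈S
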